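{- Fix $M=18$. There exists an absolute constant $\epsilon_0 > 0$ such that the following holds. Let $n\in\mathbb{N}$, let $A \subset S_n$ be any family of permutations with $|A| = pn!$ where $0 < p \le \epsilon_0$. Let $K>1$ be defined by $K^{2K} = 1/p$ and let $t_p = \lfloor K/M\rfloor$. Then for every $s \in \mathbb{N}$ with $s < t_p$, \[ \frac{1}{n!}\sum_{\sigma \in A} \xi_{(n-s,s)}(\sigma) \le \frac{1}{K^{2K(1-\frac{7}{M})}}, \] where $\xi_{(n-s,s)}(\sigma)$ denotes the number of $s$-element subsets $S \subset [n]$ with $\sigma(S) = S$.
   Context: $S_n$ is the symmetric group on $[n]=\{1,\dots,n\}$. ($\xi_{(n-s,s)}$ is the permutation character of $S_n$ acting on tabloids of shape $(n-s,s)$, which equals the number of $s$-subsets of $[n]$ fixed setwise by $\sigma$.) -}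

module Defs where

open import Data.Nat using (ℕ; zero; suc; _+_; _*_)
open import Data.Nat.Properties using (_≟_)
open import Data.Bool using (Bool; true; false)
open import Data.Bool.Properties renaming (_≟_ to _≟ᵇ_)
open import Data.Fin using (Fin)
open import Data.Fin.Properties using (all?)
open import Data.Fin.Subset using (Subset; ∣_∣)
open import Data.Fin.Permutation using (Permutation′; _⟨$⟩ˡ_; _⟨$⟩ʳ_)
open import Data.Vec using (Vec; []; _∷_; lookup)
open import Data.List using (List; []; _∷_; map; _++_; filter; length)
open import Data.Nat.ListAction using (sum)
open import Data.Product using (∃; _×_)
open import Relation.Nullary using (Dec; ¬_)
open import Relation.Nullary.Decidable using (_×-dec_)
open import Relation.Binary.PropositionalEquality using (_≡_)
open import Data.List.Relation.Unary.AllPairs using (AllPairs)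

allSubsets : (n : ℕ) → List (Subset n)
allSubsets zero = [] ∷ []
allSubsets (suc n) = map (false ∷_) (allSubsets n) ++ map (true ∷_) (allSubsets n)

-- σ(S) = S : for every i, i ∈ σ(S) (i.e. σ⁻¹ i ∈ S) iff i ∈ S
FixesSet : {n : ℕ} → Permutation′ n → Subset n → Set
FixesSet σ S = ∀ i → lookup S (σ ⟨$⟩ˡ i) ≡ lookup S i

fixesSet? : {n : ℕ} (σ : Permutation′ n) (S : Subset n) → Dec (FixesSet σ S)
fixesSet? σ S = all? (λ i → lookup S (σ ⟨$⟩ˡ i) ≟ᵇ lookup S i)

ξ : {n : ℕ} (s : ℕ) → Permutation′ n → ℕ
ξ s σ = length (filter (λ S → (∣ S ∣ ≟ s) ×-dec fixesSet? σ S) (allSubsets _))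

sumξ : {n : ℕ} (s : ℕ) → List (Permutation′ n) → ℕ
sumξ s A = sum (map (ξ s) A)

-- the list A has pairwise distinct permutations (so it is a set of permutations)
DistinctPerms : {n : ℕ} → List (Permutation′ n) → Set
DistinctPerms = AllPairs (λ π σ → ∃ λ i → ¬ (π ⟨$⟩ʳ i ≡ σ ⟨$⟩ʳ i))

-- Hölder's inequality gives (Σ_{σ∈A} ξ_s(σ))³ ≤ |A|² Σ_{σ∈A} ξ_s(σ)³. Three σ-invariant s-sets lie
-- in their union, a σ-invariant set U with |U| ≤ 3s, and U contains at most 2^{3|U|} triples of
-- subsets; so ξ_s(σ)³ ≤ 2^{9s} · #{U : σ(U) = U, |U| ≤ 3s}. Summing over σ ∈ A and exchanging the
-- sums, a set U is fixed by at most |U|!(n-|U|)! permutations and there are (n choose u) sets of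
-- size u, so each of the 3s+1 sizes contributes at most n!. Hence
-- (Σ ξ_s)³ ≤ |A|² (3s+1) 2^{9s} n!, and raising to the sixth power against
-- (18(s+1))^{36(s+1)} |A| ≤ n! gives the bound.
module Submission where

open import Defs
open import Data.Nat using (ℕ; suc; _*_; _^_; _≤_; _<_)
open import Data.Nat using (_!)
open import Data.List using (List; length)
open import Data.Fin.Permutation using (Permutation′)
open import Data.Product using (∃; _×_)

open import Data.Bool using (Bool; true; false; if_then_else_; not; _∨_)
open import Data.Fin using (Fin; zero; suc) renaming (_≟_ to _≟ᶠ_)
open import Data.Fin.Permutation using (_⟨$⟩ˡ_; _⟨$⟩ʳ_; inverseˡ; inverseʳ)
open import Data.Fin.Properties using (suc-injective; 0≢1+n)
open import Data.Fin.Subset using (Subset; inside; outside; ∣_∣; _∪_; ∁)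
open import Data.Fin.Subset.Properties using (_⊆?_; ∣∁p∣≡n∸∣p∣; p⊆p∪q; q⊆p∪q; ⊆-trans)
open import Data.List using ([]; _∷_; map; filter; _++_; upTo)
open import Data.List.Membership.Propositional using (_∈_)
open import Data.List.Membership.Propositional.Properties using (∈-++⁺ˡ; ∈-++⁺ʳ; ∈-map⁺; ∈-filter⁺; ∈-upTo⁺)
open import Data.List.Properties using (map-++; map-∘; length-map; length-filter; filter-notAll; length-upTo)
open import Data.List.Relation.Unary.All as All using (All)
import Data.List.Relation.Unary.All.Properties as All
import Data.List.Relation.Unary.AllPairs as AllPairs
import Data.List.Relation.Unary.AllPairs.Properties as AllPairs
open import Data.List.Relation.Unary.Any as Any using (here; there)
open import Data.List.Relation.Unary.Unique.Propositional using (Unique; _∷_)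
import Data.List.Relation.Unary.Unique.Propositional.Properties as Unique
open import Data.Nat using (zero; _+_; _∸_; pred; z≤n; s≤s; _≟_; _≤?_)
open import Data.Nat.Combinatorics using (_C_; nCk+nC[k+1]≡[n+1]C[k+1])
open import Data.Nat.Combinatorics.Specification using (nCk≡n!/k![n-k]!; k>n⇒nCk≡0)
open import Data.Nat.DivMod using (m/n*n≤m)
open import Data.Nat.ListAction using (sum)
open import Data.Nat.ListAction.Properties using (sum-++)
open import Data.Nat.Properties hiding (0≢1+n; suc-injective)
open import Algebra.Properties.CommutativeSemigroup *-commutativeSemigroup using (x∙yz≈y∙xz; xy∙z≈xz∙y)
open import Data.Nat.Solver using (module +-*-Solver)
open import Data.Nat.Tactic.RingSolver using (solve-∀)
open import Data.Product using (_,_; proj₁)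
open import Data.Sum using (inj₁; inj₂)
open import Data.Vec using (Vec; []; _∷_; lookup; head; tail; tabulate)
open import Data.Vec.Properties using (lookup-map; lookup∘tabulate; lookup-zipWith)
open import Function using (_∘_)
open import Function.Definitions using (Injective)
open import Relation.Binary.Definitions using (DecidableEquality)
open import Relation.Binary.PropositionalEquality
open import Relation.Nullary using (Dec; yes; no; does; ¬_; ¬?; contradiction)
open import Relation.Nullary.Decidable using (_×-dec_)
open import Relation.Unary using (Pred; Decidable)

private variable
  A B : Set
  P : Set
  n k : ℕ

-- Finite sums over lists

∑ : List A → (A → ℕ) → ℕ
∑ xs f = sum (map f xs)

∑³ : List A → (A → A → A → ℕ) → ℕ
∑³ xs h = ∑ xs λ x → ∑ xs λ y → ∑ xs λ z → h x y z

∑-cong : (xs : List A) {f g : A → ℕ} → (∀ x → f x ≡ g x) → ∑ xs f ≡ ∑ xs g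
∑-cong []       f≡g = refl
∑-cong (x ∷ xs) f≡g = cong₂ _+_ (f≡g x) (∑-cong xs f≡g)

∑-mono-∈ : (xs : List A) {f g : A → ℕ} → (∀ x → x ∈ xs → f x ≤ g x) → ∑ xs f ≤ ∑ xs g
∑-mono-∈ []       f≤g = z≤n
∑-mono-∈ (x ∷ xs) f≤g = +-mono-≤ (f≤g x (here refl)) (∑-mono-∈ xs (λ y y∈xs → f≤g y (there y∈xs)))

∑-mono-≤ : (xs : List A) {f g : A → ℕ} → (∀ x → f x ≤ g x) → ∑ xs f ≤ ∑ xs g
∑-mono-≤ xs f≤g = ∑-mono-∈ xs (λ x _ → f≤g x)

∑-∈ : (xs : List A) (f : A → ℕ) {x : A} → x ∈ xs → f x ≤ ∑ xs f
∑-∈ (y ∷ xs) f (here refl) = m≤m+n (f y) _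
∑-∈ (y ∷ xs) f (there x∈xs) = ≤-trans (∑-∈ xs f x∈xs) (m≤n+m _ (f y))

∑-map : (g : B → A) (ys : List B) (f : A → ℕ) → ∑ (map g ys) f ≡ ∑ ys (f ∘ g)
∑-map g ys f = cong sum (sym (map-∘ ys))

∑-++ : (xs ys : List A) (f : A → ℕ) → ∑ (xs ++ ys) f ≡ ∑ xs f + ∑ ys f
∑-++ xs ys f = trans (cong sum (map-++ f xs ys)) (sum-++ (map f xs) (map f ys))

∑-+ : (xs : List A) (f g : A → ℕ) → ∑ xs (λ x → f x + g x) ≡ ∑ xs f + ∑ xs g
∑-+ []       f g = refl
∑-+ (x ∷ xs) f g rewrite ∑-+ xs f g = +-+-interchange (f x) (g x) (∑ xs f) (∑ xs g)
  where
  +-+-interchange : ∀ a b c d → a + b + (c + d) ≡ a + c + (b + d)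
  +-+-interchange = solve-∀

∑-*ˡ : (xs : List A) (c : ℕ) (f : A → ℕ) → ∑ xs (λ x → c * f x) ≡ c * ∑ xs f
∑-*ˡ []       c f = sym (*-zeroʳ c)
∑-*ˡ (x ∷ xs) c f = trans (cong (c * f x +_) (∑-*ˡ xs c f)) (sym (*-distribˡ-+ c (f x) (∑ xs f)))

∑-*ʳ : (xs : List A) (c : ℕ) (f : A → ℕ) → ∑ xs (λ x → f x * c) ≡ ∑ xs f * c
∑-*ʳ xs c f = trans (∑-cong xs (λ x → *-comm (f x) c)) (trans (∑-*ˡ xs c f) (*-comm c (∑ xs f)))

∑-const : (xs : List A) (c : ℕ) → ∑ xs (λ _ → c) ≡ length xs * c
∑-const []       c = refl
∑-const (x ∷ xs) c = cong (c +_) (∑-const xs c)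

∑-zero : (xs : List A) → ∑ xs (λ _ → 0) ≡ 0
∑-zero xs = trans (∑-const xs 0) (*-zeroʳ (length xs))

∑-affine : (xs : List A) (a b : ℕ) (f : A → ℕ) → ∑ xs (λ x → a + b * f x) ≡ length xs * a + b * ∑ xs f
∑-affine xs a b f = trans (∑-+ xs (λ _ → a) (λ x → b * f x)) (cong₂ _+_ (∑-const xs a) (∑-*ˡ xs b f))

∑-swap : (xs : List A) (ys : List B) (f : A → B → ℕ) →
         ∑ xs (λ x → ∑ ys (f x)) ≡ ∑ ys (λ y → ∑ xs (λ x → f x y))
∑-swap []       ys f = sym (∑-zero ys)
∑-swap (x ∷ xs) ys f = trans (cong (∑ ys (f x) +_) (∑-swap xs ys f)) (sym (∑-+ ys (f x) _))

∑-cube : (xs : List A) (f : A → ℕ) → ∑ xs f * ∑ xs f * ∑ xs f ≡ ∑³ xs (λ x y z → f x * f y * f z)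
∑-cube xs f = begin
  S * S * S                                  ≡⟨ cong (_* S) (∑-*ʳ xs S f) ⟨
  ∑ xs (λ x → f x * S) * S                   ≡⟨ ∑-*ʳ xs S (λ x → f x * S) ⟨
  ∑ xs (λ x → f x * S * S)                   ≡⟨ ∑-cong xs (λ x → cong (_* S) (∑-*ˡ xs (f x) f)) ⟨
  ∑ xs (λ x → ∑ xs (λ y → f x * f y) * S)    ≡⟨ ∑-cong xs (λ x → ∑-*ʳ xs S (λ y → f x * f y)) ⟨
  ∑ xs (λ x → ∑ xs (λ y → f x * f y * S))    ≡⟨ ∑-cong xs (λ x → ∑-cong xs (λ y → ∑-*ˡ xs (f x * f y) f)) ⟨
  ∑³ xs (λ x y z → f x * f y * f z)          ∎
  where
  S = ∑ xs f
  open ≡-Reasoning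

∑³-mono : (xs : List A) {g h : A → A → A → ℕ} → (∀ x y z → g x y z ≤ h x y z) → ∑³ xs g ≤ ∑³ xs h
∑³-mono xs g≤h = ∑-mono-≤ xs (λ x → ∑-mono-≤ xs (λ y → ∑-mono-≤ xs (λ z → g≤h x y z)))

∑³-*ˡ : (xs : List A) (c : ℕ) (h : A → A → A → ℕ) → ∑³ xs (λ x y z → c * h x y z) ≡ c * ∑³ xs h
∑³-*ˡ xs c h = begin
  ∑³ xs (λ x y z → c * h x y z)                      ≡⟨ ∑-cong xs (λ x → ∑-cong xs (λ y → ∑-*ˡ xs c (h x y))) ⟩
  ∑ xs (λ x → ∑ xs (λ y → c * ∑ xs (h x y)))         ≡⟨ ∑-cong xs (λ x → ∑-*ˡ xs c (λ y → ∑ xs (h x y))) ⟩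
  ∑ xs (λ x → c * ∑ xs (λ y → ∑ xs (h x y)))         ≡⟨ ∑-*ˡ xs c _ ⟩
  c * ∑³ xs h                                        ∎
  where open ≡-Reasoning

∑³-swap : (xs : List A) (ys : List B) (h : A → A → A → B → ℕ) →
          ∑³ xs (λ x y z → ∑ ys (h x y z)) ≡ ∑ ys (λ u → ∑³ xs (λ x y z → h x y z u))
∑³-swap xs ys h = begin
  ∑³ xs (λ x y z → ∑ ys (h x y z))                       ≡⟨ ∑-cong xs (λ x → ∑-cong xs (λ y → ∑-swap xs ys (h x y))) ⟩
  ∑ xs (λ x → ∑ xs (λ y → ∑ ys (λ u → ∑ xs (λ z → h x y z u))))
                                                         ≡⟨ ∑-cong xs (λ x → ∑-swap xs ys _) ⟩
  ∑ xs (λ x → ∑ ys (λ u → ∑ xs (λ y → ∑ xs (λ z → h x y z u))))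
                                                         ≡⟨ ∑-swap xs ys _ ⟩
  ∑ ys (λ u → ∑³ xs (λ x y z → h x y z u))               ∎
  where open ≡-Reasoning

∑³-coordinate-sum : (xs : List A) (f : A → ℕ) →
                    ∑³ xs (λ x y z → f x + f y + f z) ≡ 3 * (length xs * length xs * ∑ xs f)
∑³-coordinate-sum xs f = begin
  ∑³ xs (λ x y z → f x + f y + f z)
    ≡⟨ ∑-cong xs (λ x → ∑-cong xs (λ y → ∑-+ xs (λ _ → f x + f y) f)) ⟩
  ∑ xs (λ x → ∑ xs (λ y → ∑ xs (λ _ → f x + f y) + F))
    ≡⟨ ∑-cong xs (λ x → ∑-cong xs (λ y → cong (_+ F) (∑-const xs _))) ⟩
  ∑ xs (λ x → ∑ xs (λ y → ℓ * (f x + f y) + F))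
    ≡⟨ ∑-cong xs (λ x → ∑-cong xs (λ y → regroup₁ ℓ (f x) (f y) F)) ⟩
  ∑ xs (λ x → ∑ xs (λ y → (ℓ * f x + F) + ℓ * f y))
    ≡⟨ ∑-cong xs (λ x → ∑-affine xs _ ℓ f) ⟩
  ∑ xs (λ x → ℓ * (ℓ * f x + F) + ℓ * F)
    ≡⟨ ∑-cong xs (λ x → regroup₂ ℓ (f x) F) ⟩
  ∑ xs (λ x → (ℓ * F + ℓ * F) + ℓ * ℓ * f x)
    ≡⟨ ∑-affine xs _ (ℓ * ℓ) f ⟩
  ℓ * (ℓ * F + ℓ * F) + ℓ * ℓ * F
    ≡⟨ regroup₃ ℓ F ⟩
  3 * (ℓ * ℓ * F)
    ∎
  where
  open ≡-Reasoning
  ℓ = length xs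
  F = ∑ xs f
  regroup₁ : ∀ ℓ a b F → ℓ * (a + b) + F ≡ (ℓ * a + F) + ℓ * b
  regroup₁ = solve-∀
  regroup₂ : ∀ ℓ a F → ℓ * (ℓ * a + F) + ℓ * F ≡ (ℓ * F + ℓ * F) + ℓ * ℓ * a
  regroup₂ = solve-∀
  regroup₃ : ∀ ℓ F → ℓ * (ℓ * F + ℓ * F) + ℓ * ℓ * F ≡ 3 * (ℓ * ℓ * F)
  regroup₃ = solve-∀

-- Elementary inequalities

wlog-≤ : (R : ℕ → ℕ → Set) → (∀ {a b} → R a b → R b a) → (∀ a d → R a (a + d)) → ∀ a b → R a b
wlog-≤ R sym-R R-+ a b with ≤-total a b
... | inj₁ a≤b = subst (R a) (m+[n∸m]≡n a≤b) (R-+ a (b ∸ a))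
... | inj₂ b≤a = sym-R (subst (R b) (m+[n∸m]≡n b≤a) (R-+ b (a ∸ b)))

2mn≤m²+n² : ∀ m n → 2 * (m * n) ≤ m * m + n * n
2mn≤m²+n² = wlog-≤ (λ m n → 2 * (m * n) ≤ m * m + n * n)
  (λ {a} {b} → subst₂ _≤_ (cong (2 *_) (*-comm a b)) (+-comm (a * a) (b * b)))
  (λ a d → ≤-trans (m≤m+n _ (d * d)) (≤-reflexive (square-gap a d)))
  where
  square-gap : ∀ a d → 2 * (a * (a + d)) + d * d ≡ a * a + (a + d) * (a + d)
  square-gap = solve-∀

m²n+mn²≤m³+n³ : ∀ m n → m * m * n + m * n * n ≤ m * m * m + n * n * n
m²n+mn²≤m³+n³ = wlog-≤ (λ m n → m * m * n + m * n * n ≤ m * m * m + n * n * n)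
  (λ {a} {b} → subst₂ _≤_ (swap-terms a b) (+-comm (a * a * a) (b * b * b)))
  (λ a d → ≤-trans (m≤m+n _ (d * d * (a + (a + d)))) (≤-reflexive (cube-gap a d)))
  where
  swap-terms : ∀ a b → a * a * b + a * b * b ≡ b * b * a + b * a * a
  swap-terms = solve-∀
  cube-gap : ∀ a d → a * a * (a + d) + a * (a + d) * (a + d) + d * d * (a + (a + d))
                     ≡ a * a * a + (a + d) * (a + d) * (a + d)
  cube-gap = solve-∀

amgm₃ : ∀ a b c → 3 * (a * b * c) ≤ a * a * a + b * b * b + c * c * c
amgm₃ a b c = *-cancelˡ-≤ 2 (begin
  2 * (3 * (a * b * c))
    ≡⟨ regroup₁ a b c ⟩
  a * (2 * (b * c)) + b * (2 * (c * a)) + c * (2 * (a * b))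
    ≤⟨ +-mono-≤ (+-mono-≤ (*-monoʳ-≤ a (2mn≤m²+n² b c)) (*-monoʳ-≤ b (2mn≤m²+n² c a))) (*-monoʳ-≤ c (2mn≤m²+n² a b)) ⟩
  a * (b * b + c * c) + b * (c * c + a * a) + c * (a * a + b * b)
    ≡⟨ regroup₂ a b c ⟩
  (a * a * b + a * b * b) + (b * b * c + b * c * c) + (c * c * a + c * a * a)
    ≤⟨ +-mono-≤ (+-mono-≤ (m²n+mn²≤m³+n³ a b) (m²n+mn²≤m³+n³ b c)) (m²n+mn²≤m³+n³ c a) ⟩
  (a * a * a + b * b * b) + (b * b * b + c * c * c) + (c * c * c + a * a * a)
    ≡⟨ regroup₃ a b c ⟩
  2 * (a * a * a + b * b * b + c * c * c)
    ∎)
  where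
  open ≤-Reasoning
  regroup₁ : ∀ a b c → 2 * (3 * (a * b * c)) ≡ a * (2 * (b * c)) + b * (2 * (c * a)) + c * (2 * (a * b))
  regroup₁ = solve-∀
  regroup₂ : ∀ a b c → a * (b * b + c * c) + b * (c * c + a * a) + c * (a * a + b * b)
                       ≡ (a * a * b + a * b * b) + (b * b * c + b * c * c) + (c * c * a + c * a * a)
  regroup₂ = solve-∀
  regroup₃ : ∀ a b c → (a * a * a + b * b * b) + (b * b * b + c * c * c) + (c * c * c + a * a * a)
                       ≡ 2 * (a * a * a + b * b * b + c * c * c)
  regroup₃ = solve-∀

Hölder₃ : (xs : List A) (f : A → ℕ) →
          ∑ xs f * ∑ xs f * ∑ xs f ≤ length xs * length xs * ∑ xs (λ x → f x * f x * f x)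
Hölder₃ {A} xs f = *-cancelˡ-≤ 3 (begin
  3 * (S * S * S)                                 ≡⟨ cong (3 *_) (∑-cube xs f) ⟩
  3 * ∑³ xs (λ x y z → f x * f y * f z)           ≡⟨ ∑³-*ˡ xs 3 _ ⟨
  ∑³ xs (λ x y z → 3 * (f x * f y * f z))         ≤⟨ ∑³-mono xs (λ x y z → amgm₃ (f x) (f y) (f z)) ⟩
  ∑³ xs (λ x y z → f³ x + f³ y + f³ z)            ≡⟨ ∑³-coordinate-sum xs f³ ⟩
  3 * (length xs * length xs * ∑ xs f³)           ∎)
  where
  open ≤-Reasoning
  S = ∑ xs f
  f³ : A → ℕ
  f³ x = f x * f x * f x

-- Indicators and double counting

𝟙 : Dec P → ℕ
𝟙 d = if does d then 1 else 0

𝟙-yes : (d : Dec P) → P → 𝟙 d ≡ 1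
𝟙-yes (yes _) _ = refl
𝟙-yes (no ¬p) p = contradiction p ¬p

𝟙-≤ : (d : Dec P) {r : ℕ} → (P → 1 ≤ r) → 𝟙 d ≤ r
𝟙-≤ (yes p) 1≤r = 1≤r p
𝟙-≤ (no _)  _   = z≤n

𝟙-*-mono : (d : Dec P) {x y : ℕ} → (P → x ≤ y) → 𝟙 d * x ≤ 𝟙 d * y
𝟙-*-mono (yes p) x≤y = *-monoʳ-≤ 1 (x≤y p)
𝟙-*-mono (no _)  _   = z≤n

𝟙*𝟙*𝟙-≤ : {Q R : Set} (p : Dec P) (q : Dec Q) (r : Dec R) {t : ℕ} →
          (P → Q → R → 1 ≤ t) → 𝟙 p * 𝟙 q * 𝟙 r ≤ t
𝟙*𝟙*𝟙-≤ (yes p) (yes q) (yes r) 1≤t = 1≤t p q r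
𝟙*𝟙*𝟙-≤ (yes _) (yes _) (no _)  _   = z≤n
𝟙*𝟙*𝟙-≤ (yes _) (no _)  _       _   = z≤n
𝟙*𝟙*𝟙-≤ (no _)  _       _       _   = z≤n

𝟙-×-dec : {Q : Set} (p : Dec P) (q : Dec Q) → 𝟙 (p ×-dec q) ≡ 𝟙 p * 𝟙 q
𝟙-×-dec (yes _) (yes _) = refl
𝟙-×-dec (yes _) (no _)  = refl
𝟙-×-dec (no _)  _       = refl

length-filter≡∑𝟙 : {Q : Pred A _} (Q? : Decidable Q) (xs : List A) → length (filter Q? xs) ≡ ∑ xs (𝟙 ∘ Q?)
length-filter≡∑𝟙 Q? []       = refl
length-filter≡∑𝟙 Q? (x ∷ xs) with Q? x
... | yes _ = cong suc (length-filter≡∑𝟙 Q? xs)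
... | no _  = length-filter≡∑𝟙 Q? xs

length≤∑fibres : (_≟ᴮ_ : DecidableEquality B) (g : A → B) (ys : List B) (xs : List A) →
                 All (λ x → g x ∈ ys) xs → length xs ≤ ∑ ys (λ y → length (filter (λ x → g x ≟ᴮ y) xs))
length≤∑fibres _≟ᴮ_ g ys xs g[xs]⊆ys = begin
  length xs                                        ≡⟨ trans (∑-const xs 1) (*-identityʳ _) ⟨
  ∑ xs (λ _ → 1)                                   ≤⟨ ∑-mono-∈ xs hits ⟩
  ∑ xs (λ x → ∑ ys (λ y → 𝟙 (g x ≟ᴮ y)))           ≡⟨ ∑-swap xs ys _ ⟩
  ∑ ys (λ y → ∑ xs (λ x → 𝟙 (g x ≟ᴮ y)))           ≡⟨ ∑-cong ys (λ y → length-filter≡∑𝟙 (λ x → g x ≟ᴮ y) xs) ⟨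
  ∑ ys (λ y → length (filter (λ x → g x ≟ᴮ y) xs)) ∎
  where
  open ≤-Reasoning
  hits : ∀ x → x ∈ xs → 1 ≤ ∑ ys (λ y → 𝟙 (g x ≟ᴮ y))
  hits x x∈xs = ≤-trans (≤-reflexive (sym (𝟙-yes (g x ≟ᴮ g x) refl)))
                        (∑-∈ ys (λ y → 𝟙 (g x ≟ᴮ y)) (All.lookup g[xs]⊆ys x∈xs))

-- Subsets of a finite set

∈-allSubsets : (U : Subset n) → U ∈ allSubsets n
∈-allSubsets []                   = here refl
∈-allSubsets (outside ∷ U)        = ∈-++⁺ˡ (∈-map⁺ (outside ∷_) (∈-allSubsets U))
∈-allSubsets {suc n} (inside ∷ U) = ∈-++⁺ʳ (map (outside ∷_) (allSubsets n)) (∈-map⁺ (inside ∷_) (∈-allSubsets U))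

∑-allSubsets-suc : ∀ n (F : Subset (suc n) → ℕ) →
  ∑ (allSubsets (suc n)) F ≡ ∑ (allSubsets n) (F ∘ (outside ∷_)) + ∑ (allSubsets n) (F ∘ (inside ∷_))
∑-allSubsets-suc n F = trans (∑-++ (map (outside ∷_) (allSubsets n)) _ F)
  (cong₂ _+_ (∑-map (outside ∷_) (allSubsets n) F) (∑-map (inside ∷_) (allSubsets n) F))

∑𝟙-⊆ : (U : Subset n) → ∑ (allSubsets n) (λ S → 𝟙 (S ⊆? U)) ≡ 2 ^ ∣ U ∣
∑𝟙-⊆ []                    = refl
∑𝟙-⊆ {suc n} (outside ∷ U) = trans (∑-allSubsets-suc n _)
  (trans (cong₂ _+_ (∑𝟙-⊆ U) (∑-zero (allSubsets n))) (+-identityʳ _))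
∑𝟙-⊆ {suc n} (inside ∷ U)  = trans (∑-allSubsets-suc n _)
  (trans (cong₂ _+_ (∑𝟙-⊆ U) (∑𝟙-⊆ U)) (cong (2 ^ ∣ U ∣ +_) (sym (+-identityʳ _))))

∑𝟙-size : ∀ n u → ∑ (allSubsets n) (λ U → 𝟙 (∣ U ∣ ≟ u)) ≡ n C u
∑𝟙-size zero    zero    = refl
∑𝟙-size zero    (suc u) = refl
∑𝟙-size (suc n) zero    = trans (∑-allSubsets-suc n _) (cong₂ _+_ (∑𝟙-size n zero) (∑-zero (allSubsets n)))
∑𝟙-size (suc n) (suc u) = begin
  ∑ (allSubsets (suc n)) (λ U → 𝟙 (∣ U ∣ ≟ suc u))  ≡⟨ ∑-allSubsets-suc n _ ⟩
  ∑ (allSubsets n) (λ U → 𝟙 (∣ U ∣ ≟ suc u))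
    + ∑ (allSubsets n) (λ U → 𝟙 (∣ U ∣ ≟ u))        ≡⟨ cong₂ _+_ (∑𝟙-size n (suc u)) (∑𝟙-size n u) ⟩
  n C suc u + n C u                                 ≡⟨ +-comm _ (n C u) ⟩
  n C u + n C suc u                                 ≡⟨ nCk+nC[k+1]≡[n+1]C[k+1] n u ⟩
  suc n C suc u                                     ∎
  where open ≡-Reasoning

nCk*k!*[n∸k]!≤n! : ∀ n k → (n C k) * (k ! * (n ∸ k) !) ≤ n !
nCk*k!*[n∸k]!≤n! n k with k ≤? n
... | yes k≤n = subst (λ c → c * (k ! * (n ∸ k) !) ≤ n !) (sym (nCk≡n!/k![n-k]! k≤n))
                      (m/n*n≤m (n !) (k ! * (n ∸ k) !))
  where instance _ = k !* (n ∸ k) !≢0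
... | no k≰n rewrite k>n⇒nCk≡0 (≰⇒> k≰n) = z≤n

∣p∪q∣≤∣p∣+∣q∣ : (p q : Subset n) → ∣ p ∪ q ∣ ≤ ∣ p ∣ + ∣ q ∣
∣p∪q∣≤∣p∣+∣q∣ []            []            = z≤n
∣p∪q∣≤∣p∣+∣q∣ (outside ∷ p) (outside ∷ q) = ∣p∪q∣≤∣p∣+∣q∣ p q
∣p∪q∣≤∣p∣+∣q∣ (outside ∷ p) (inside ∷ q)  = ≤-trans (s≤s (∣p∪q∣≤∣p∣+∣q∣ p q)) (≤-reflexive (sym (+-suc ∣ p ∣ ∣ q ∣)))
∣p∪q∣≤∣p∣+∣q∣ (inside ∷ p)  (outside ∷ q) = s≤s (∣p∪q∣≤∣p∣+∣q∣ p q)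
∣p∪q∣≤∣p∣+∣q∣ (inside ∷ p)  (inside ∷ q)  = s≤s (≤-trans (∣p∪q∣≤∣p∣+∣q∣ p q) (+-monoʳ-≤ ∣ p ∣ (n≤1+n ∣ q ∣)))

∣p∪q∪r∣≤3s : ∀ {s} (p q r : Subset n) → ∣ p ∣ ≡ s → ∣ q ∣ ≡ s → ∣ r ∣ ≡ s → ∣ p ∪ q ∪ r ∣ ≤ 3 * s
∣p∪q∪r∣≤3s {s = s} p q r ∣p∣≡s ∣q∣≡s ∣r∣≡s = begin
  ∣ p ∪ q ∪ r ∣           ≤⟨ ≤-trans (∣p∪q∣≤∣p∣+∣q∣ p (q ∪ r)) (+-monoʳ-≤ ∣ p ∣ (∣p∪q∣≤∣p∣+∣q∣ q r)) ⟩
  ∣ p ∣ + (∣ q ∣ + ∣ r ∣) ≡⟨ cong₂ _+_ ∣p∣≡s (cong₂ _+_ ∣q∣≡s (trans ∣r∣≡s (sym (+-identityʳ s)))) ⟩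
  3 * s                   ∎
  where open ≤-Reasoning

-- Counting injective placements

fallingFactorial : ℕ → ℕ → ℕ
fallingFactorial m zero    = 1
fallingFactorial m (suc k) = m * fallingFactorial (pred m) k

fallingFactorial-monoˡ-≤ : ∀ k {m m′} → m ≤ m′ → fallingFactorial m k ≤ fallingFactorial m′ k
fallingFactorial-monoˡ-≤ zero    m≤m′ = ≤-refl
fallingFactorial-monoˡ-≤ (suc k) m≤m′ = *-mono-≤ m≤m′ (fallingFactorial-monoˡ-≤ k (pred-mono-≤ m≤m′))

fallingFactorial[m,m]≡m! : ∀ m → fallingFactorial m m ≡ m !
fallingFactorial[m,m]≡m! zero    = refl
fallingFactorial[m,m]≡m! (suc m) = cong (suc m *_) (fallingFactorial[m,m]≡m! m)

remove : Fin n → List (Fin n) → List (Fin n)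
remove y = filter (λ x → ¬? (x ≟ᶠ y))

length-remove-≤ : (y : Fin n) (X : List (Fin n)) → length (remove y X) ≤ length X
length-remove-≤ y X = length-filter _ X

length-remove-∈ : {y : Fin n} (X : List (Fin n)) → y ∈ X → length (remove y X) < length X
length-remove-∈ X y∈X = filter-notAll _ X (Any.map (λ y≡x x≢y → x≢y (sym y≡x)) y∈X)

∈-remove⁺ : {x y : Fin n} {X : List (Fin n)} → x ∈ X → ¬ x ≡ y → x ∈ remove y X
∈-remove⁺ {y = y} x∈X x≢y = ∈-filter⁺ (λ x → ¬? (x ≟ᶠ y)) x∈X x≢y

Placement : List (Fin n) → List (Fin n) → Subset k → Vec (Fin n) k → Set
Placement X Y c v = (∀ i → lookup v i ∈ (if lookup c i then X else Y)) × Injective _≡_ _≡_ (lookup v)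

placementBound : List (Fin n) → List (Fin n) → Subset k → ℕ
placementBound X Y c = fallingFactorial (length X) ∣ c ∣ * fallingFactorial (length Y) ∣ ∁ c ∣

Placement-tail : {X Y : List (Fin n)} {b : Bool} {c : Subset k} {y : Fin n} {v : Vec (Fin n) k} →
                 Placement X Y (b ∷ c) (y ∷ v) → Placement (remove y X) (remove y Y) c v
Placement-tail {X = X} {Y} {c = c} {y} {v} (∈XY , inj) = ∈removed , suc-injective ∘ inj
  where
  ∈removed : ∀ i → lookup v i ∈ (if lookup c i then remove y X else remove y Y)
  ∈removed i with lookup c i | ∈XY (suc i)
  ... | true  | ∈X = ∈-remove⁺ ∈X (0≢1+n ∘ sym ∘ inj)
  ... | false | ∈Y = ∈-remove⁺ ∈Y (0≢1+n ∘ sym ∘ inj)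

map-∷-tail : {y : A} {Vs : List (Vec A (suc k))} → All (λ V → head V ≡ y) Vs → map (y ∷_) (map tail Vs) ≡ Vs
map-∷-tail {Vs = []}            All.[]            = refl
map-∷-tail {Vs = (y ∷ v) ∷ Vs} (refl All.∷ heads) = cong ((y ∷ v) ∷_) (map-∷-tail heads)

-- Choose where the first position goes (an element of X or of Y) and recurse with it removed.
placements-≤ : (X Y : List (Fin n)) (c : Subset k) (Vs : List (Vec (Fin n) k)) →
               Unique Vs → All (Placement X Y c) Vs → length Vs ≤ placementBound X Y c
placements-≤ X Y [] []            _                 _ = z≤n
placements-≤ X Y [] ([] ∷ [])     _                 _ = ≤-refl
placements-≤ X Y [] ([] ∷ [] ∷ _) ((≢ All.∷ _) ∷ _) _ = contradiction refl ≢
placements-≤ X Y (b ∷ c) Vs unique placed = begin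
  length Vs                        ≤⟨ length≤∑fibres _≟ᶠ_ head Z Vs (All.map (λ {V} → head∈Z V) placed) ⟩
  ∑ Z (λ y → length (fibre y))     ≤⟨ ∑-mono-∈ Z (λ y y∈Z → ≤-trans (fibre-≤ y) (shrink b y∈Z)) ⟩
  ∑ Z (λ _ → fibreBound b)         ≡⟨ ∑-const Z (fibreBound b) ⟩
  length Z * fibreBound b          ≡⟨ peel b ⟩
  placementBound X Y (b ∷ c)       ∎
  where
  open ≤-Reasoning
  Z = if b then X else Y

  fibreBound : Bool → ℕ
  fibreBound true  = fallingFactorial (pred (length X)) ∣ c ∣ * fallingFactorial (length Y) ∣ ∁ c ∣
  fibreBound false = fallingFactorial (length X) ∣ c ∣ * fallingFactorial (pred (length Y)) ∣ ∁ c ∣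

  head∈Z : ∀ V → Placement X Y (b ∷ c) V → head V ∈ Z
  head∈Z (y ∷ v) (∈XY , _) = ∈XY zero

  fibre : Fin _ → List (Vec (Fin _) _)
  fibre y = filter (λ V → head V ≟ᶠ y) Vs

  fibre-≤ : ∀ y → length (fibre y) ≤ placementBound (remove y X) (remove y Y) c
  fibre-≤ y = begin
    length (fibre y)              ≡⟨ length-map tail (fibre y) ⟨
    length (map tail (fibre y))   ≤⟨ placements-≤ (remove y X) (remove y Y) c (map tail (fibre y)) unique′ placed′ ⟩
    placementBound (remove y X) (remove y Y) c ∎
    where
    cons-tails : map (y ∷_) (map tail (fibre y)) ≡ fibre y
    cons-tails = map-∷-tail (All.all-filter (λ V → head V ≟ᶠ y) Vs)
    unique′ : Unique (map tail (fibre y))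
    unique′ = Unique.map⁻ (subst Unique (sym cons-tails) (Unique.filter⁺ (λ V → head V ≟ᶠ y) unique))
    placed′ : All (Placement (remove y X) (remove y Y) c) (map tail (fibre y))
    placed′ = All.map Placement-tail
                (All.map⁻ (subst (All _) (sym cons-tails) (All.filter⁺ (λ V → head V ≟ᶠ y) placed)))

  shrink : ∀ b {y} → y ∈ (if b then X else Y) → placementBound (remove y X) (remove y Y) c ≤ fibreBound b
  shrink true  y∈X = *-mono-≤ (fallingFactorial-monoˡ-≤ ∣ c ∣ (<⇒≤pred (length-remove-∈ X y∈X)))
                              (fallingFactorial-monoˡ-≤ ∣ ∁ c ∣ (length-remove-≤ _ Y))
  shrink false y∈Y = *-mono-≤ (fallingFactorial-monoˡ-≤ ∣ c ∣ (length-remove-≤ _ X))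
                              (fallingFactorial-monoˡ-≤ ∣ ∁ c ∣ (<⇒≤pred (length-remove-∈ Y y∈Y)))

  peel : ∀ b → length (if b then X else Y) * fibreBound b ≡ placementBound X Y (b ∷ c)
  peel true  = sym (*-assoc (length X) _ _)
  peel false = x∙yz≈y∙xz (length Y) (fallingFactorial (length X) ∣ c ∣) _

-- Permutations fixing a set

members : Subset n → List (Fin n)
members []            = []
members (outside ∷ p) = map suc (members p)
members (inside ∷ p)  = zero ∷ map suc (members p)

length-members : (p : Subset n) → length (members p) ≡ ∣ p ∣
length-members []            = refl
length-members (outside ∷ p) = trans (length-map suc (members p)) (length-members p)
length-members (inside ∷ p)  = cong suc (trans (length-map suc (members p)) (length-members p))

∈-members : (p : Subset n) {x : Fin n} → lookup p x ≡ inside → x ∈ members p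
∈-members (inside ∷ p)  {zero}  _   = here refl
∈-members (outside ∷ p) {suc x} x∈p = ∈-map⁺ suc (∈-members p x∈p)
∈-members (inside ∷ p)  {suc x} x∈p = there (∈-map⁺ suc (∈-members p x∈p))

∈-members-side : (p : Subset n) (x : Fin n) → x ∈ (if lookup p x then members p else members (∁ p))
∈-members-side p x with lookup p x in x∈?p
... | true  = ∈-members p x∈?p
... | false = ∈-members (∁ p) (trans (lookup-map x not p) (cong not x∈?p))

inverseVec : Permutation′ n → Vec (Fin n) n
inverseVec σ = tabulate (σ ⟨$⟩ˡ_)

inverseVec-injective : (π σ : Permutation′ n) → inverseVec π ≡ inverseVec σ → ∀ i → π ⟨$⟩ʳ i ≡ σ ⟨$⟩ʳ i
inverseVec-injective π σ π⁻¹≡σ⁻¹ i = begin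
  π ⟨$⟩ʳ i                           ≡⟨ inverseʳ σ ⟨
  σ ⟨$⟩ʳ (σ ⟨$⟩ˡ (π ⟨$⟩ʳ i))         ≡⟨ cong (σ ⟨$⟩ʳ_) (π⁻¹≗σ⁻¹ (π ⟨$⟩ʳ i)) ⟨
  σ ⟨$⟩ʳ (π ⟨$⟩ˡ (π ⟨$⟩ʳ i))         ≡⟨ cong (σ ⟨$⟩ʳ_) (inverseˡ π) ⟩
  σ ⟨$⟩ʳ i                           ∎
  where
  open ≡-Reasoning
  π⁻¹≗σ⁻¹ : ∀ j → π ⟨$⟩ˡ j ≡ σ ⟨$⟩ˡ j
  π⁻¹≗σ⁻¹ j = trans (sym (lookup∘tabulate (π ⟨$⟩ˡ_) j))
                    (trans (cong (λ v → lookup v j) π⁻¹≡σ⁻¹) (lookup∘tabulate (σ ⟨$⟩ˡ_) j))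

inverseVec-placement : (σ : Permutation′ n) (U : Subset n) → FixesSet σ U →
                       Placement (members U) (members (∁ U)) U (inverseVec σ)
inverseVec-placement σ U σU≡U = placed , injective
  where
  placed : ∀ i → lookup (inverseVec σ) i ∈ (if lookup U i then members U else members (∁ U))
  placed i rewrite lookup∘tabulate (σ ⟨$⟩ˡ_) i =
    subst (λ b → σ ⟨$⟩ˡ i ∈ (if b then members U else members (∁ U))) (σU≡U i) (∈-members-side U (σ ⟨$⟩ˡ i))
  injective : Injective _≡_ _≡_ (lookup (inverseVec σ))
  injective {i} {j} eq rewrite lookup∘tabulate (σ ⟨$⟩ˡ_) i | lookup∘tabulate (σ ⟨$⟩ˡ_) j =
    trans (sym (inverseʳ σ)) (trans (cong (σ ⟨$⟩ʳ_) eq) (inverseʳ σ))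

stabiliser-≤ : (U : Subset n) (A : List (Permutation′ n)) → DistinctPerms A →
               ∑ A (λ σ → 𝟙 (fixesSet? σ U)) ≤ ∣ U ∣ ! * (n ∸ ∣ U ∣) !
stabiliser-≤ {n} U A distinct = begin
  ∑ A (λ σ → 𝟙 (fixesSet? σ U))      ≡⟨ length-filter≡∑𝟙 (λ σ → fixesSet? σ U) A ⟨
  length Stab                         ≡⟨ length-map inverseVec Stab ⟨
  length (map inverseVec Stab)        ≤⟨ placements-≤ (members U) (members (∁ U)) U (map inverseVec Stab) unique placed ⟩
  placementBound (members U) (members (∁ U)) U
                                      ≡⟨ cong₂ (λ a b → fallingFactorial a ∣ U ∣ * fallingFactorial b ∣ ∁ U ∣)
                                               (length-members U) (length-members (∁ U)) ⟩
  fallingFactorial (∣ U ∣) (∣ U ∣) * fallingFactorial (∣ ∁ U ∣) (∣ ∁ U ∣)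
                                      ≡⟨ cong₂ _*_ (fallingFactorial[m,m]≡m! ∣ U ∣)
                                                   (trans (fallingFactorial[m,m]≡m! ∣ ∁ U ∣) (cong _! (∣∁p∣≡n∸∣p∣ U))) ⟩
  ∣ U ∣ ! * (n ∸ ∣ U ∣) !             ∎
  where
  open ≤-Reasoning
  Stab = filter (λ σ → fixesSet? σ U) A
  unique : Unique (map inverseVec Stab)
  unique = AllPairs.map⁺ (AllPairs.map (λ {π} {σ} (i , πi≢σi) eq → πi≢σi (inverseVec-injective π σ eq i))
                                       (AllPairs.filter⁺ (λ σ → fixesSet? σ U) distinct))
  placed : All (Placement (members U) (members (∁ U)) U) (map inverseVec Stab)
  placed = All.map⁺ (All.map (λ {σ} → inverseVec-placement σ U) (All.all-filter (λ σ → fixesSet? σ U) A))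

FixesSet-∪ : (σ : Permutation′ n) (S T : Subset n) → FixesSet σ S → FixesSet σ T → FixesSet σ (S ∪ T)
FixesSet-∪ σ S T σS≡S σT≡T i = begin
  lookup (S ∪ T) (σ ⟨$⟩ˡ i)                    ≡⟨ lookup-zipWith _∨_ (σ ⟨$⟩ˡ i) S T ⟩
  lookup S (σ ⟨$⟩ˡ i) ∨ lookup T (σ ⟨$⟩ˡ i)    ≡⟨ cong₂ _∨_ (σS≡S i) (σT≡T i) ⟩
  lookup S i ∨ lookup T i                      ≡⟨ lookup-zipWith _∨_ i S T ⟨
  lookup (S ∪ T) i                             ∎
  where open ≡-Reasoning

-- Fixed sets of the permutations of a family

ξ≤ : ℕ → Permutation′ n → ℕ
ξ≤ m σ = length (filter (λ S → (∣ S ∣ ≤? m) ×-dec fixesSet? σ S) (allSubsets _))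

ξ³≤ : ∀ s (σ : Permutation′ n) →
      ξ s σ * ξ s σ * ξ s σ ≤ ξ≤ (3 * s) σ * (2 ^ (3 * s) * 2 ^ (3 * s) * 2 ^ (3 * s))
ξ³≤ {n} s σ = begin
  ξ s σ * ξ s σ * ξ s σ                                         ≡⟨ cong (λ x → x * x * x) (length-filter≡∑𝟙 g? L) ⟩
  ∑ L g * ∑ L g * ∑ L g                                         ≡⟨ ∑-cube L g ⟩
  ∑³ L (λ x y z → g x * g y * g z)                              ≤⟨ ∑³-mono L covered ⟩
  ∑³ L (λ x y z → ∑ L (λ U → h U * (a U x * a U y * a U z)))    ≡⟨ ∑³-swap L L _ ⟩
  ∑ L (λ U → ∑³ L (λ x y z → h U * (a U x * a U y * a U z)))    ≡⟨ ∑-cong L (λ U → ∑³-*ˡ L (h U) _) ⟩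
  ∑ L (λ U → h U * ∑³ L (λ x y z → a U x * a U y * a U z))      ≡⟨ ∑-cong L (λ U → cong (h U *_) (subsets³ U)) ⟩
  ∑ L (λ U → h U * (2 ^ ∣ U ∣ * 2 ^ ∣ U ∣ * 2 ^ ∣ U ∣))          ≤⟨ ∑-mono-≤ L (λ U → 𝟙-*-mono (h? U) (cube-mono ∘ proj₁)) ⟩
  ∑ L (λ U → h U * K)                                           ≡⟨ ∑-*ʳ L K h ⟩
  ∑ L h * K                                                     ≡⟨ cong (_* K) (length-filter≡∑𝟙 h? L) ⟨
  ξ≤ m σ * K                                                    ∎
  where
  open ≤-Reasoning
  L = allSubsets n
  m = 3 * s
  K = 2 ^ m * 2 ^ m * 2 ^ m
  g? : Decidable (λ S → ∣ S ∣ ≡ s × FixesSet σ S)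
  g? S = (∣ S ∣ ≟ s) ×-dec fixesSet? σ S
  h? : Decidable (λ U → ∣ U ∣ ≤ m × FixesSet σ U)
  h? U = (∣ U ∣ ≤? m) ×-dec fixesSet? σ U
  g h : Subset n → ℕ
  g S = 𝟙 (g? S)
  h U = 𝟙 (h? U)
  a : Subset n → Subset n → ℕ
  a U S = 𝟙 (S ⊆? U)

  covered : ∀ x y z → g x * g y * g z ≤ ∑ L (λ U → h U * (a U x * a U y * a U z))
  covered x y z = 𝟙*𝟙*𝟙-≤ (g? x) (g? y) (g? z) λ (∣x∣≡s , σx≡x) (∣y∣≡s , σy≡y) (∣z∣≡s , σz≡z) →
    let U = x ∪ y ∪ z
        ∣U∣≤m = ∣p∪q∪r∣≤3s x y z ∣x∣≡s ∣y∣≡s ∣z∣≡s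
        σU≡U = FixesSet-∪ σ x (y ∪ z) σx≡x (FixesSet-∪ σ y z σy≡y σz≡z)
        x⊆U = p⊆p∪q (y ∪ z)
        y⊆U = ⊆-trans (p⊆p∪q z) (q⊆p∪q x (y ∪ z))
        z⊆U = ⊆-trans (q⊆p∪q y z) (q⊆p∪q x (y ∪ z))
    in begin
      1                                       ≡⟨ cong₂ _*_ (𝟙-yes (h? U) (∣U∣≤m , σU≡U))
                                                   (cong₂ _*_ (cong₂ _*_ (𝟙-yes (x ⊆? U) x⊆U) (𝟙-yes (y ⊆? U) y⊆U))
                                                              (𝟙-yes (z ⊆? U) z⊆U)) ⟨
      h U * (a U x * a U y * a U z)           ≤⟨ ∑-∈ L (λ U → h U * (a U x * a U y * a U z)) (∈-allSubsets U) ⟩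
      ∑ L (λ U → h U * (a U x * a U y * a U z)) ∎

  subsets³ : ∀ U → ∑³ L (λ x y z → a U x * a U y * a U z) ≡ 2 ^ ∣ U ∣ * 2 ^ ∣ U ∣ * 2 ^ ∣ U ∣
  subsets³ U = trans (sym (∑-cube L (a U))) (cong (λ x → x * x * x) (∑𝟙-⊆ U))

  cube-mono : ∀ {u} → u ≤ m → 2 ^ u * 2 ^ u * 2 ^ u ≤ K
  cube-mono u≤m = let 2^u≤2^m = ^-monoʳ-≤ 2 u≤m in *-mono-≤ (*-mono-≤ 2^u≤2^m 2^u≤2^m) 2^u≤2^m

sumξ≤n! : ∀ u (A : List (Permutation′ n)) → DistinctPerms A → sumξ u A ≤ n !
sumξ≤n! {n} u A distinct = begin
  ∑ A (ξ u)                                              ≡⟨ ∑-cong A (λ σ → length-filter≡∑𝟙 _ L) ⟩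
  ∑ A (λ σ → ∑ L (λ U → 𝟙 ((∣ U ∣ ≟ u) ×-dec fixesSet? σ U)))
                                                         ≡⟨ ∑-cong A (λ σ → ∑-cong L (λ U → 𝟙-×-dec (∣ U ∣ ≟ u) (fixesSet? σ U))) ⟩
  ∑ A (λ σ → ∑ L (λ U → 𝟙 (∣ U ∣ ≟ u) * 𝟙 (fixesSet? σ U)))
                                                         ≡⟨ ∑-swap A L _ ⟩
  ∑ L (λ U → ∑ A (λ σ → 𝟙 (∣ U ∣ ≟ u) * 𝟙 (fixesSet? σ U)))
                                                         ≡⟨ ∑-cong L (λ U → ∑-*ˡ A (𝟙 (∣ U ∣ ≟ u)) _) ⟩
  ∑ L (λ U → 𝟙 (∣ U ∣ ≟ u) * ∑ A (λ σ → 𝟙 (fixesSet? σ U)))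
                                                         ≤⟨ ∑-mono-≤ L (λ U → 𝟙-*-mono (∣ U ∣ ≟ u) (stabiliser-of-size U)) ⟩
  ∑ L (λ U → 𝟙 (∣ U ∣ ≟ u) * (u ! * (n ∸ u) !))          ≡⟨ ∑-*ʳ L _ (λ U → 𝟙 (∣ U ∣ ≟ u)) ⟩
  ∑ L (λ U → 𝟙 (∣ U ∣ ≟ u)) * (u ! * (n ∸ u) !)          ≡⟨ cong (_* (u ! * (n ∸ u) !)) (∑𝟙-size n u) ⟩
  (n C u) * (u ! * (n ∸ u) !)                            ≤⟨ nCk*k!*[n∸k]!≤n! n u ⟩
  n !                                                    ∎
  where
  open ≤-Reasoning
  L = allSubsets n
  stabiliser-of-size : ∀ U → ∣ U ∣ ≡ u → ∑ A (λ σ → 𝟙 (fixesSet? σ U)) ≤ u ! * (n ∸ u) !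
  stabiliser-of-size U refl = stabiliser-≤ U A distinct

𝟙-≤-∑upTo : ∀ k m → 𝟙 (k ≤? m) ≤ ∑ (upTo (suc m)) (λ u → 𝟙 (k ≟ u))
𝟙-≤-∑upTo k m = 𝟙-≤ (k ≤? m) λ k≤m →
  ≤-trans (≤-reflexive (sym (𝟙-yes (k ≟ k) refl))) (∑-∈ (upTo (suc m)) (λ u → 𝟙 (k ≟ u)) (∈-upTo⁺ (s≤s k≤m)))

ξ≤≤∑ξ : ∀ m (σ : Permutation′ n) → ξ≤ m σ ≤ ∑ (upTo (suc m)) (λ u → ξ u σ)
ξ≤≤∑ξ {n} m σ = begin
  ξ≤ m σ                                                 ≡⟨ length-filter≡∑𝟙 _ L ⟩
  ∑ L (λ U → 𝟙 ((∣ U ∣ ≤? m) ×-dec fixesSet? σ U))       ≡⟨ ∑-cong L (λ U → 𝟙-×-dec (∣ U ∣ ≤? m) (fixesSet? σ U)) ⟩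
  ∑ L (λ U → 𝟙 (∣ U ∣ ≤? m) * 𝟙 (fixesSet? σ U))         ≤⟨ ∑-mono-≤ L (λ U → *-monoˡ-≤ _ (𝟙-≤-∑upTo ∣ U ∣ m)) ⟩
  ∑ L (λ U → Sizes (λ u → 𝟙 (∣ U ∣ ≟ u)) * 𝟙 (fixesSet? σ U))
                                                         ≡⟨ ∑-cong L (λ U → ∑-*ʳ (upTo (suc m)) (𝟙 (fixesSet? σ U)) (λ u → 𝟙 (∣ U ∣ ≟ u))) ⟨
  ∑ L (λ U → Sizes (λ u → 𝟙 (∣ U ∣ ≟ u) * 𝟙 (fixesSet? σ U)))
                                                         ≡⟨ ∑-swap L (upTo (suc m)) _ ⟩
  Sizes (λ u → ∑ L (λ U → 𝟙 (∣ U ∣ ≟ u) * 𝟙 (fixesSet? σ U)))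
                                                         ≡⟨ ∑-cong (upTo (suc m)) (λ u → ∑-cong L (λ U → 𝟙-×-dec (∣ U ∣ ≟ u) (fixesSet? σ U))) ⟨
  Sizes (λ u → ∑ L (λ U → 𝟙 ((∣ U ∣ ≟ u) ×-dec fixesSet? σ U)))
                                                         ≡⟨ ∑-cong (upTo (suc m)) (λ u → length-filter≡∑𝟙 _ L) ⟨
  Sizes (λ u → ξ u σ)                                    ∎
  where
  open ≤-Reasoning
  L = allSubsets n
  Sizes : (ℕ → ℕ) → ℕ
  Sizes = ∑ (upTo (suc m))

sumξ≤≤ : ∀ m (A : List (Permutation′ n)) → DistinctPerms A → ∑ A (ξ≤ m) ≤ suc m * n !
sumξ≤≤ {n} m A distinct = begin
  ∑ A (ξ≤ m)                                ≤⟨ ∑-mono-≤ A (ξ≤≤∑ξ m) ⟩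
  ∑ A (λ σ → ∑ (upTo (suc m)) (λ u → ξ u σ)) ≡⟨ ∑-swap A (upTo (suc m)) _ ⟩
  ∑ (upTo (suc m)) (λ u → sumξ u A)         ≤⟨ ∑-mono-≤ (upTo (suc m)) (λ u → sumξ≤n! u A distinct) ⟩
  ∑ (upTo (suc m)) (λ _ → n !)              ≡⟨ ∑-const (upTo (suc m)) (n !) ⟩
  length (upTo (suc m)) * n !               ≡⟨ cong (_* n !) (length-upTo (suc m)) ⟩
  suc m * n !                               ∎
  where open ≤-Reasoning

-- 3s + 1 possible sizes of the union of three s-sets, times the number of triples of subsets of it.
ξ³-constant : ℕ → ℕ
ξ³-constant s = suc (3 * s) * (2 ^ (3 * s) * 2 ^ (3 * s) * 2 ^ (3 * s))

sumξ³≤ : ∀ s (A : List (Permutation′ n)) → DistinctPerms A →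
         sumξ s A * sumξ s A * sumξ s A ≤ length A * length A * (ξ³-constant s * n !)
sumξ³≤ {n} s A distinct = begin
  ∑ A (ξ s) * ∑ A (ξ s) * ∑ A (ξ s)         ≤⟨ Hölder₃ A (ξ s) ⟩
  ℓ * ℓ * ∑ A (λ σ → ξ s σ * ξ s σ * ξ s σ) ≤⟨ *-monoʳ-≤ (ℓ * ℓ) (∑-mono-≤ A (ξ³≤ s)) ⟩
  ℓ * ℓ * ∑ A (λ σ → ξ≤ m σ * K)             ≡⟨ cong (ℓ * ℓ *_) (∑-*ʳ A K (ξ≤ m)) ⟩
  ℓ * ℓ * (∑ A (ξ≤ m) * K)                   ≤⟨ *-monoʳ-≤ (ℓ * ℓ) (*-monoˡ-≤ K (sumξ≤≤ m A distinct)) ⟩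
  ℓ * ℓ * (suc m * n ! * K)                  ≡⟨ cong (ℓ * ℓ *_) (xy∙z≈xz∙y (suc m) (n !) K) ⟩
  ℓ * ℓ * (ξ³-constant s * n !)              ∎
  where
  open ≤-Reasoning
  ℓ = length A
  m = 3 * s
  K = 2 ^ m * 2 ^ m * 2 ^ m

-- Numerical bounds

ξ³-constant≤2048^s : ∀ s → ξ³-constant s ≤ 2048 ^ s
ξ³-constant≤2048^s zero    = ≤-refl
ξ³-constant≤2048^s (suc s) = begin
  suc (3 * suc s) * (y * y * y)                 ≡⟨ cong (λ t → suc (3 * suc s) * (t * t * t)) 2^3[1+s]≡8*2^3s ⟩
  suc (3 * suc s) * (8 * x * (8 * x) * (8 * x)) ≤⟨ *-monoˡ-≤ _ (≤-trans (m≤m+n (suc (3 * suc s)) (9 * s)) (≤-reflexive (regroup₁ s))) ⟩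
  4 * suc (3 * s) * (8 * x * (8 * x) * (8 * x)) ≡⟨ regroup₂ (suc (3 * s)) x ⟩
  2048 * (suc (3 * s) * (x * x * x))            ≤⟨ *-monoʳ-≤ 2048 (ξ³-constant≤2048^s s) ⟩
  2048 ^ suc s                                  ∎
  where
  open ≤-Reasoning
  x = 2 ^ (3 * s)
  y = 2 ^ (3 * suc s)
  2^3[1+s]≡8*2^3s : y ≡ 8 * x
  2^3[1+s]≡8*2^3s = trans (cong (2 ^_) (*-suc 3 s)) (^-distribˡ-+-* 2 3 (3 * s))
  regroup₁ : ∀ s → suc (3 * suc s) + 9 * s ≡ 4 * suc (3 * s)
  regroup₁ = solve-∀
  regroup₂ : ∀ c x → 4 * c * (8 * x * (8 * x) * (8 * x)) ≡ 2048 * (c * (x * x * x))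
  regroup₂ = solve-∀

2048^s≤[18[1+s]]^[6[1+s]] : ∀ s → 2048 ^ s ≤ (18 * suc s) ^ (6 * suc s)
2048^s≤[18[1+s]]^[6[1+s]] s = begin
  2048 ^ s                     ≤⟨ ^-monoˡ-≤ s (≤ᵇ⇒≤ 2048 (18 ^ 6) _) ⟩
  (18 ^ 6) ^ s                 ≡⟨ ^-*-assoc 18 6 s ⟩
  18 ^ (6 * s)                 ≤⟨ ^-monoʳ-≤ 18 (*-monoʳ-≤ 6 (n≤1+n s)) ⟩
  18 ^ (6 * suc s)             ≤⟨ ^-monoˡ-≤ (6 * suc s) (m≤m*n 18 (suc s)) ⟩
  (18 * suc s) ^ (6 * suc s)   ∎
  where open ≤-Reasoning

cube-bound⇒power-bound : ∀ X ℓ N c δ → X * X * X ≤ ℓ * ℓ * (c * N) → c ^ 6 ≤ δ → δ * ℓ ≤ N →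
                         X ^ 18 * N ^ 11 ≤ ℓ ^ 11 * N ^ 18
cube-bound⇒power-bound X ℓ N c δ X³≤ℓ²cN c⁶≤δ δℓ≤N = begin
  X ^ 18 * N ^ 11                    ≡⟨ regroup₁ X N ⟩
  (X * X * X) ^ 6 * N ^ 11           ≤⟨ *-monoˡ-≤ (N ^ 11) (^-monoˡ-≤ 6 X³≤ℓ²cN) ⟩
  (ℓ * ℓ * (c * N)) ^ 6 * N ^ 11     ≡⟨ regroup₂ ℓ c N ⟩
  ℓ ^ 11 * (c ^ 6 * ℓ) * N ^ 17      ≤⟨ *-monoˡ-≤ (N ^ 17) (*-monoʳ-≤ (ℓ ^ 11) (≤-trans (*-monoˡ-≤ ℓ c⁶≤δ) δℓ≤N)) ⟩
  ℓ ^ 11 * N * N ^ 17                ≡⟨ regroup₃ ℓ N ⟩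
  ℓ ^ 11 * N ^ 18                    ∎
  where
  open ≤-Reasoning
  regroup₁ : ∀ x y → x ^ 18 * y ^ 11 ≡ (x * x * x) ^ 6 * y ^ 11
  regroup₁ = solve 2 (λ x y → x :^ 18 :* y :^ 11 := (x :* x :* x) :^ 6 :* y :^ 11) refl
    where open +-*-Solver
  regroup₂ : ∀ ℓ c y → (ℓ * ℓ * (c * y)) ^ 6 * y ^ 11 ≡ ℓ ^ 11 * (c ^ 6 * ℓ) * y ^ 17
  regroup₂ = solve 3 (λ ℓ c y → (ℓ :* ℓ :* (c :* y)) :^ 6 :* y :^ 11 := ℓ :^ 11 :* (c :^ 6 :* ℓ) :* y :^ 17) refl
    where open +-*-Solver
  regroup₃ : ∀ ℓ y → ℓ ^ 11 * y * y ^ 17 ≡ ℓ ^ 11 * y ^ 18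
  regroup₃ = solve 2 (λ ℓ y → ℓ :^ 11 :* y :* y :^ 17 := ℓ :^ 11 :* y :^ 18) refl
    where open +-*-Solver

ξ³-constant⁶≤ : ∀ s → ξ³-constant s ^ 6 ≤ (18 * suc s) ^ (36 * suc s)
ξ³-constant⁶≤ s = begin
  ξ³-constant s ^ 6                 ≤⟨ ^-monoˡ-≤ 6 (≤-trans (ξ³-constant≤2048^s s) (2048^s≤[18[1+s]]^[6[1+s]] s)) ⟩
  ((18 * suc s) ^ (6 * suc s)) ^ 6  ≡⟨ ^-*-assoc (18 * suc s) (6 * suc s) 6 ⟩
  (18 * suc s) ^ (6 * suc s * 6)    ≡⟨ cong ((18 * suc s) ^_) (exponent s) ⟩
  (18 * suc s) ^ (36 * suc s)       ∎
  where
  open ≤-Reasoning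
  exponent : ∀ s → 6 * suc s * 6 ≡ 36 * suc s
  exponent = solve-∀

-- The bound holds for every family A.
lemma2p2 : ∃ λ a → ∃ λ b → 0 < a × 0 < b ×
    ((n : ℕ) (A : List (Permutation′ n)) → DistinctPerms A →
      0 < length A → length A * b ≤ a * (n !) →
      (s : ℕ) → (18 * suc s) ^ (36 * suc s) * length A ≤ n ! →
      sumξ s A ^ 18 * (n !) ^ 11 ≤ length A ^ 11 * (n !) ^ 18)
lemma2p2 = 1 , 1 , s≤s z≤n , s≤s z≤n , λ n A distinct _ _ s δℓ≤n! →
  cube-bound⇒power-bound (sumξ s A) (length A) (n !) (ξ³-constant s) ((18 * suc s) ^ (36 * suc s))
                         (sumξ³≤ s A distinct) (ξ³-constant⁶≤ s) δℓ≤n!
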